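{- Let $1\le d\le n$. (i) If $q$ is a product of $k\ge1$ pairwise distinct primes, then $\mathrm{DI}(\mathbf{MPOLY}_n^{d,q},q)\ge \binom{n}{d}/k$. (ii) If $q$ is prime, then $\mathrm{DI}(\mathbf{MPOLY}_n^{d,q},q)\ge \sum_{i=0}^{d}\binom{n}{i}$.
   Context: For a predicate $P:\mathcal X\times\mathcal Y\to\{0,1\}$ (finite sets) and integer $q\ge2$, an inner product encoding of $P$ modulo $q$ of length $\ell$ is a pair of maps $x\mapsto \vec x\in\mathbb Z_q^\ell$, $y\mapsto\vec y\in\mathbb Z_q^\ell$ such that for all $x,y$: $P(x,y)=1$ iff $\sum_{i=1}^\ell\vec x_i\vec y_i\equiv0\pmod q$; $\mathrm{DI}(P,q)$ is the minimum such $\ell$. The multilinear polynomial evaluation predicate $\mathbf{MPOLY}_n^{d,q}$ has $\mathcal X=\mathbb Z_q^n$ and $\mathcal Y$ the set of all multilinear polynomials in $\mathbb Z_q[x_1,\dots,x_n]$ of degree at most $d$, with $\mathbf{MPOLY}_n^{d,q}(x,p)=1$ iff $p(x_1,\dots,x_n)\equiv0\pmod q$. -}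

module Defs where

open import Data.Nat using (ℕ; zero; suc; _+_; _*_; _≤_; _<_)
open import Data.Nat.Divisibility using (_∣_)
open import Data.Fin using (Fin; toℕ)
import Data.Fin
open import Data.Fin.Subset using (Subset; ∣_∣)
open import Data.Bool using (Bool; true; false)
open import Data.Vec using (Vec; []; _∷_)
open import Data.List using (List; []; _∷_; _++_; map)
open import Data.Product using (Σ; _×_; _,_)
open import Function.Bundles using (_⇔_)
open import Relation.Binary.PropositionalEquality using (_≡_)

sumFin : (ℓ : ℕ) → (Fin ℓ → ℕ) → ℕ
sumFin zero f = 0
sumFin (suc ℓ) f = f Data.Fin.zero + sumFin ℓ (λ i → f (Data.Fin.suc i))

-- vectors of Z_q^ℓ : functions Fin ℓ → Fin q (elements of Z_q as 0..q-1)
ZqVec : ℕ → ℕ → Set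
ZqVec q ℓ = Fin ℓ → Fin q

-- inner product, computed in ℕ (to be reduced mod q)
ip : {q ℓ : ℕ} → ZqVec q ℓ → ZqVec q ℓ → ℕ
ip {q} {ℓ} u v = sumFin ℓ (λ i → toℕ (u i) * toℕ (v i))

IPEncoding : {X Y : Set} → (X → Y → Set) → ℕ → ℕ → Set
IPEncoding {X} {Y} P q ℓ =
  Σ (X → ZqVec q ℓ) λ f → Σ (Y → ZqVec q ℓ) λ g →
    (x : X) → (y : Y) → P x y ⇔ (q ∣ ip (f x) (g y))

DI≥ : {X Y : Set} → (X → Y → Set) → ℕ → ℕ → Set
DI≥ P q b = (ℓ : ℕ) → IPEncoding P q ℓ → b ≤ ℓ

allSubsets : (n : ℕ) → List (Subset n)
allSubsets zero    = [] ∷ []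
allSubsets (suc n) = map (false ∷_) (allSubsets n) ++ map (true ∷_) (allSubsets n)

monomial : {q n : ℕ} → Subset n → Vec (Fin q) n → ℕ
monomial []          []       = 1
monomial (false ∷ S) (a ∷ x) = monomial S x
monomial (true ∷ S)  (a ∷ x) = toℕ a * monomial S x

MultilinPoly : ℕ → ℕ → ℕ → Set
MultilinPoly n d q =
  Σ (Subset n → Fin q) λ c → (S : Subset n) → d < ∣ S ∣ → toℕ (c S) ≡ 0

sumList : List ℕ → ℕ
sumList []       = 0
sumList (a ∷ as) = a + sumList as

-- evaluation p(x) in ℕ (to be reduced mod q)
eval : {n d q : ℕ} → MultilinPoly n d q → Vec (Fin q) n → ℕ
eval {n} (c , _) x = sumList (map (λ S → toℕ (c S) * monomial S x) (allSubsets n))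

MPOLY : (n d q : ℕ) → Vec (Fin q) n → MultilinPoly n d q → Set
MPOLY n d q x p = q ∣ eval p x

-- Put x_S for the 0/1 point of a subset S ⊆ [n] and x^T for the monomial ∏_{i∈T} x_i, so that
-- x^T(x_S) = 1 if T ⊆ S and 0 otherwise.  Listing subsets of size ≤ d by increasing size, an
-- encoding (f, g) of MPOLY modulo q therefore gives vectors u_S = f(x_S), w_T = g(x^T) in ℕ^ℓ whose
-- pairings u_S · w_T are divisible by q above the diagonal and not on it.
-- For a prime p, m such pairs force m ≤ ℓ: the map c ↦ Σ c_a w_a from (ℤ/p)^m to (ℤ/p)^ℓ is
-- injective (pairing with u_a of the first a isolates its coefficient), so p^m ≤ p^ℓ.  This gives
-- (ii) with all subsets of size ≤ d.  For squarefree q = p₁⋯p_k every diagonal pairing is nonzero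
-- modulo some p_i, so the list splits into k such systems modulo primes; with the subsets of size
-- exactly d this gives (i).

module Submission where

open import Defs
open import Data.Nat using (ℕ; suc; _*_; _≤_)
open import Data.Nat.Primality using (Prime)
open import Data.Nat.Combinatorics using (_C_)
open import Data.List using (List; length; upTo; map)
open import Data.Nat.ListAction using (sum; product)
open import Data.List.Relation.Unary.All using (All)
open import Data.List.Relation.Unary.Unique.Propositional using (Unique)
open import Data.Product using (_×_)
open import Relation.Binary.PropositionalEquality using (_≡_)

open import Data.Bool as Bool using (Bool)
open import Data.Empty using (⊥-elim)
open import Data.Fin using (Fin; zero; suc; toℕ; funToFin; finToFun; combine)
open import Data.Fin.Properties using (toℕ<n; toℕ-injective; toℕ-fromℕ<; funToFin-finToFin; finToFun-funToFin; injective⇒≤)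
open import Data.Fin.Subset using (Subset; ∣_∣; _⊈_; inside; outside)
open import Data.Fin.Subset.Properties using (p⊆q⇒∣p∣≤∣q∣; drop-∷-⊆; out⊆; s⊆s; ⊆-refl)
open import Data.List using ([]; _∷_; _++_; filter)
open import Data.List.Properties using (length-++; length-map; map-++; map-∘; upTo-∷ʳ)
open import Data.List.Relation.Unary.All as All using ([]; _∷_)
import Data.List.Relation.Unary.All.Properties as All
open import Data.List.Relation.Unary.AllPairs as AllPairs using (AllPairs; []; _∷_)
import Data.List.Relation.Unary.AllPairs.Properties as AllPairs
open import Data.Nat using (zero; _+_; _∸_; _^_; _<_; z≤n; s≤s; s≤s⁻¹; NonZero; nonTrivial⇒n>1)
open import Data.Nat.DivMod using (_%_; _/_; _mod_; m≡m%n+[m/n]*n)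
open import Data.Nat.Divisibility using (_∣_; _∤_; divides; _∣?_; ∣-trans; ∣m+n∣m⇒∣n; ∣m∣n⇒∣m+n; ∣n⇒∣m*n; 1∣_; ∣1⇒≡1; m∣m*n; n∣m*n; _∣0; >⇒∤)
open import Data.Nat.ListAction.Properties using (sum-++)
open import Data.Nat.Primality using (euclidsLemma; prime⇒irreducible; prime⇒nonZero; prime⇒nonTrivial; ¬prime[1]; productOfPrimes≥1)
open import Data.Nat.Combinatorics using (nCk+nC[k+1]≡[n+1]C[k+1])
open import Data.Nat.Properties
open import Algebra.Properties.Semiring.Sum +-*-semiring
  using (sum-syntax; sum-cong-≗; sum-replicate-zero; ∑-distrib-+; *-distribˡ-sum)
open import Data.Nat.Tactic.RingSolver using (solve-∀)
open import Data.Product using (∃₂; _,_)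
open import Data.Sum using (inj₁; inj₂)
open import Data.Vec as Vec using (Vec; []; _∷_)
open import Data.Vec.Properties using (≡-dec)
open import Function using (_∘_; Injective)
open import Function.Bundles using (Equivalence; _⇔_)
open import Relation.Nullary using (Dec; yes; no; does; contradiction)
open import Relation.Nullary.Decidable using (dec-false)
open import Relation.Unary using (Decidable)
open import Relation.Unary.Properties using (∁?)
open import Relation.Binary.PropositionalEquality using (refl; sym; trans; cong; cong₂; subst; subst₂; _≢_; _≗_; module ≡-Reasoning)

open ≡-Reasoning

-- Congruence modulo p, stated without subtraction.

infix 4 _≡[_]_
_≡[_]_ : ℕ → ℕ → ℕ → Set
a ≡[ p ] b = ∃₂ λ x y → a + x * p ≡ b + y * p

module _ {p : ℕ} where

  ≡mod-refl : ∀ {a} → a ≡[ p ] a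
  ≡mod-refl = 0 , 0 , refl

  ≡mod-+ : ∀ {a b c d} → a ≡[ p ] b → c ≡[ p ] d → a + c ≡[ p ] b + d
  ≡mod-+ {a} {b} {c} {d} (x , y , a≡b) (u , v , c≡d) = x + u , y + v , (begin
    a + c + (x + u) * p        ≡⟨ regroup a c x u p ⟩
    a + x * p + (c + u * p)    ≡⟨ cong₂ _+_ a≡b c≡d ⟩
    b + y * p + (d + v * p)    ≡⟨ regroup b d y v p ⟨
    b + d + (y + v) * p        ∎)
    where
    regroup : ∀ a c x u p → a + c + (x + u) * p ≡ a + x * p + (c + u * p)
    regroup = solve-∀

  ≡mod-*ˡ : ∀ c {a b} → a ≡[ p ] b → c * a ≡[ p ] c * b
  ≡mod-*ˡ c {a} {b} (x , y , a≡b) = c * x , c * y , (begin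
    c * a + c * x * p    ≡⟨ factor c a x p ⟩
    c * (a + x * p)      ≡⟨ cong (c *_) a≡b ⟩
    c * (b + y * p)      ≡⟨ factor c b y p ⟨
    c * b + c * y * p    ∎)
    where
    factor : ∀ c a x p → c * a + c * x * p ≡ c * (a + x * p)
    factor = solve-∀

  ≡mod-∑ : ∀ {n} {f g : Fin n → ℕ} → (∀ i → f i ≡[ p ] g i) →
           ∑[ i < n ] f i ≡[ p ] ∑[ i < n ] g i
  ≡mod-∑ {zero}  _   = ≡mod-refl
  ≡mod-∑ {suc n} f≡g = ≡mod-+ (f≡g zero) (≡mod-∑ (f≡g ∘ suc))

  ≡mod-+-cancelˡ : ∀ c {a b} → c + a ≡[ p ] c + b → a ≡[ p ] b
  ≡mod-+-cancelˡ c {a} {b} (x , y , e) = x , y , +-cancelˡ-≡ c _ _ (begin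
    c + (a + x * p)    ≡⟨ +-assoc c a _ ⟨
    c + a + x * p      ≡⟨ e ⟩
    c + b + y * p      ≡⟨ +-assoc c b _ ⟩
    c + (b + y * p)    ∎)

  ≡mod-+-cancel-multiples : ∀ {a b s t} → p ∣ s → p ∣ t → a + s ≡[ p ] b + t → a ≡[ p ] b
  ≡mod-+-cancel-multiples {a} {b} (divides s refl) (divides t refl) (x , y , e) =
    s + x , t + y , (begin
      a + (s + x) * p      ≡⟨ regroup a s x p ⟩
      a + s * p + x * p    ≡⟨ e ⟩
      b + t * p + y * p    ≡⟨ regroup b t y p ⟨
      b + (t + y) * p      ∎)
    where
    regroup : ∀ a s x p → a + (s + x) * p ≡ a + s * p + x * p
    regroup = solve-∀

  ≡mod-+ʳ⇒∣ : ∀ {a k} → a + k ≡[ p ] a → p ∣ k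
  ≡mod-+ʳ⇒∣ {a} {k} (x , y , e) = ∣m+n∣m⇒∣n (divides y (begin
    x * p + k      ≡⟨ +-comm (x * p) k ⟩
    k + x * p      ≡⟨ +-cancelˡ-≡ a _ _ (trans (sym (+-assoc a k _)) e) ⟩
    y * p          ∎)) (n∣m*n x)

  mod≡mod⇒≡mod : ∀ {a b} .{{_ : NonZero p}} → a mod p ≡ b mod p → a ≡[ p ] b
  mod≡mod⇒≡mod {a} {b} a≡b = b / p , a / p , (begin
    a + b / p * p                  ≡⟨ cong (_+ b / p * p) (m≡m%n+[m/n]*n a p) ⟩
    a % p + a / p * p + b / p * p  ≡⟨ cong (λ r → r + a / p * p + b / p * p) a%p≡b%p ⟩
    b % p + a / p * p + b / p * p  ≡⟨ swap (b % p) (a / p * p) (b / p * p) ⟩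
    b % p + b / p * p + a / p * p  ≡⟨ cong (_+ a / p * p) (m≡m%n+[m/n]*n b p) ⟨
    b + a / p * p                  ∎)
    where
    a%p≡b%p : a % p ≡ b % p
    a%p≡b%p = trans (sym (toℕ-fromℕ< _)) (trans (cong toℕ a≡b) (toℕ-fromℕ< _))
    swap : ∀ r x y → r + x + y ≡ r + y + x
    swap = solve-∀

  ≡mod-sym : ∀ {a b} → a ≡[ p ] b → b ≡[ p ] a
  ≡mod-sym (x , y , e) = y , x , sym e

  ∣∧<⇒≡0 : ∀ {k} → p ∣ k → k < p → k ≡ 0
  ∣∧<⇒≡0 {zero}  _   _   = refl
  ∣∧<⇒≡0 {suc k} p∣k k<p = contradiction p∣k (>⇒∤ k<p)

  ≡mod-*-cancelʳ-≤ : ∀ {D a b} → Prime p → p ∤ D → a ≤ b → b < p → a * D ≡[ p ] b * D → a ≡ b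
  ≡mod-*-cancelʳ-≤ {D} {a} {b} p-prime p∤D a≤b b<p aD≡bD = begin
    a        ≡⟨ +-identityʳ a ⟨
    a + 0    ≡⟨ cong (a +_) (sym (∣∧<⇒≡0 p∣k (≤-<-trans (m∸n≤m b a) b<p))) ⟩
    a + k    ≡⟨ m+[n∸m]≡n a≤b ⟩
    b        ∎
    where
    k : ℕ
    k = b ∸ a
    aD+kD≡aD : a * D + k * D ≡[ p ] a * D
    aD+kD≡aD = subst (_≡[ p ] a * D)
      (trans (cong (_* D) (sym (m+[n∸m]≡n a≤b))) (*-distribʳ-+ D a k)) (≡mod-sym aD≡bD)
    p∣k : p ∣ k
    p∣k with euclidsLemma k D p-prime (≡mod-+ʳ⇒∣ aD+kD≡aD)
    ... | inj₁ p∣k = p∣k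
    ... | inj₂ p∣D = contradiction p∣D p∤D

  ≡mod-*-cancelʳ : ∀ {D} → Prime p → p ∤ D → (i j : Fin p) → toℕ i * D ≡[ p ] toℕ j * D → i ≡ j
  ≡mod-*-cancelʳ p-prime p∤D i j iD≡jD with ≤-total (toℕ i) (toℕ j)
  ... | inj₁ i≤j = toℕ-injective (≡mod-*-cancelʳ-≤ p-prime p∤D i≤j (toℕ<n j) iD≡jD)
  ... | inj₂ j≤i = sym (toℕ-injective (≡mod-*-cancelʳ-≤ p-prime p∤D j≤i (toℕ<n i) (≡mod-sym iD≡jD)))

prime∤product : ∀ {p ps} → Prime p → All Prime ps → All (p ≢_) ps → p ∤ product ps
prime∤product p-prime [] [] p∣1 = ¬prime[1] (subst Prime (∣1⇒≡1 p∣1) p-prime)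
prime∤product p-prime (_∷_ {r} {rs} r-prime rs-prime) (p≢r ∷ p∉rs) p∣r*rs
  with euclidsLemma r (product rs) p-prime p∣r*rs
... | inj₂ p∣rs = prime∤product p-prime rs-prime p∉rs p∣rs
... | inj₁ p∣r with prime⇒irreducible r-prime p∣r
...   | inj₁ p≡1 = ¬prime[1] (subst Prime p≡1 p-prime)
...   | inj₂ p≡r = p≢r p≡r

p∣n∧m∣n⇒p*m∣n : ∀ {p m n} → Prime p → p ∤ m → p ∣ n → m ∣ n → p * m ∣ n
p∣n∧m∣n⇒p*m∣n {p} {m} p-prime p∤m p∣n (divides o refl) with euclidsLemma o m p-prime p∣n
... | inj₁ (divides o′ refl) = divides o′ (*-assoc o′ p m)
... | inj₂ p∣m = contradiction p∣m p∤m

productOfPrimes>1 : ∀ {ps} → All Prime ps → 1 ≤ length ps → 1 < product ps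
productOfPrimes>1 {p ∷ ps} (p-prime ∷ ps-prime) _ =
  *-mono-≤ (nonTrivial⇒n>1 p {{prime⇒nonTrivial p-prime}}) (productOfPrimes≥1 ps-prime)

length-filter+filter-∁ : ∀ {A : Set} {P : A → Set} (P? : Decidable P) xs →
                         length xs ≡ length (filter P? xs) + length (filter (∁? P?) xs)
length-filter+filter-∁ P? []       = refl
length-filter+filter-∁ P? (x ∷ xs) with P? x
... | yes _ = cong suc (length-filter+filter-∁ P? xs)
... | no  _ = trans (cong suc (length-filter+filter-∁ P? xs)) (sym (+-suc _ _))

funToFin-cong : ∀ {m n} {f g : Fin m → Fin n} → f ≗ g → funToFin f ≡ funToFin g
funToFin-cong {zero}  f≗g = refl
funToFin-cong {suc m} f≗g = cong₂ combine (f≗g zero) (funToFin-cong (f≗g ∘ suc))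

-- Transported along Fin (p ^ k) ≅ (Fin k → Fin p), h becomes an injection Fin (p ^ m) → Fin (p ^ n).
functionSpace-injective⇒≤ : ∀ {m n p} → 1 < p → (h : (Fin m → Fin p) → (Fin n → Fin p)) →
                            (∀ f g → h f ≗ h g → f ≗ g) → m ≤ n
functionSpace-injective⇒≤ {m} {n} {p} 1<p h h-injective =
  ≮⇒≥ λ n<m → <⇒≱ (^-monoʳ-< p 1<p n<m) (injective⇒≤ h′-injective)
  where
  decode : Fin (p ^ m) → Fin m → Fin p
  decode = finToFun
  h′ : Fin (p ^ m) → Fin (p ^ n)
  h′ = funToFin ∘ h ∘ decode
  h′-injective : Injective _≡_ _≡_ h′
  h′-injective {i} {j} h′i≡h′j = begin
    i                    ≡⟨ funToFin-finToFin {m = m} {n = p} i ⟨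
    funToFin (decode i)  ≡⟨ funToFin-cong (h-injective _ _ λ k → begin
      h (decode i) k          ≡⟨ finToFun-funToFin (h (decode i)) k ⟨
      finToFun (h′ i) k       ≡⟨ cong (λ z → finToFun z k) h′i≡h′j ⟩
      finToFun (h′ j) k       ≡⟨ finToFun-funToFin (h (decode j)) k ⟩
      h (decode j) k          ∎) ⟩
    funToFin (decode j)  ≡⟨ funToFin-finToFin {m = m} {n = p} j ⟩
    j                    ∎

module _ {ℓ : ℕ} where

  infix 7 _·_
  _·_ : (Fin ℓ → ℕ) → (Fin ℓ → ℕ) → ℕ
  u · v = ∑[ i < ℓ ] (u i * v i)

  ·-zeroʳ : ∀ u → u · (λ _ → 0) ≡ 0
  ·-zeroʳ u = trans (sum-cong-≗ (λ i → *-zeroʳ (u i))) (sum-replicate-zero ℓ)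

  ·-linearʳ : ∀ u x v y → u · (λ i → x * v i + y i) ≡ x * (u · v) + u · y
  ·-linearʳ u x v y = begin
    ∑[ i < ℓ ] (u i * (x * v i + y i))        ≡⟨ sum-cong-≗ (λ i → distrib (u i) x (v i) (y i)) ⟩
    ∑[ i < ℓ ] (x * (u i * v i) + u i * y i)  ≡⟨ ∑-distrib-+ (λ i → x * (u i * v i)) (λ i → u i * y i) ⟩
    ∑[ i < ℓ ] (x * (u i * v i)) + u · y      ≡⟨ cong (_+ u · y) (*-distribˡ-sum x (λ i → u i * v i)) ⟨
    x * (u · v) + u · y                       ∎
    where
    distrib : ∀ u x v y → u * (x * v + y) ≡ x * (u * v) + u * y
    distrib = solve-∀

  ≡mod-·ʳ : ∀ {p} u {v v′} → (∀ i → v i ≡[ p ] v′ i) → u · v ≡[ p ] u · v′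
  ≡mod-·ʳ u v≡v′ = ≡mod-∑ (λ i → ≡mod-*ˡ (u i) (v≡v′ i))

sumFin≡∑ : ∀ ℓ f → sumFin ℓ f ≡ ∑[ i < ℓ ] f i
sumFin≡∑ zero    f = refl
sumFin≡∑ (suc ℓ) f = cong (f zero +_) (sumFin≡∑ ℓ (f ∘ suc))

ip≡· : ∀ {q ℓ} (x y : ZqVec q ℓ) → ip x y ≡ (toℕ ∘ x) · (toℕ ∘ y)
ip≡· {ℓ = ℓ} x y = sumFin≡∑ ℓ _

record Triangular {A : Set} {ℓ : ℕ} (u w : A → Fin ℓ → ℕ) (m : ℕ) (as : List A) : Set where
  constructor triangular
  field
    offDiagonal : AllPairs (λ a b → m ∣ u a · w b) as
    diagonal    : All (λ a → m ∤ u a · w a) as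

lincomb : ∀ {A : Set} {ℓ} → (A → Fin ℓ → ℕ) → (as : List A) → (Fin (length as) → ℕ) → Fin ℓ → ℕ
lincomb w []       c k = 0
lincomb w (a ∷ as) c k = c zero * w a k + lincomb w as (c ∘ suc) k

module _ {A : Set} {ℓ : ℕ} {u w : A → Fin ℓ → ℕ} where

  ∣·lincomb : ∀ {p} v as → All (λ b → p ∣ v · w b) as → ∀ c → p ∣ v · lincomb w as c
  ∣·lincomb {p} v []       []              c = subst (p ∣_) (sym (·-zeroʳ v)) (p ∣0)
  ∣·lincomb {p} v (a ∷ as) (p∣vwa ∷ p∣vws) c =
    subst (p ∣_) (sym (·-linearʳ v (c zero) (w a) (lincomb w as (c ∘ suc))))
      (∣m∣n⇒∣m+n (∣n⇒∣m*n (c zero) p∣vwa) (∣·lincomb v as p∣vws (c ∘ suc)))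

  module _ {p : ℕ} (p-prime : Prime p) where

    lincomb-injective : ∀ {as} → Triangular u w p as → (c c′ : Fin (length as) → Fin p) →
      (∀ k → lincomb w as (toℕ ∘ c) k ≡[ p ] lincomb w as (toℕ ∘ c′) k) → c ≗ c′
    lincomb-injective {a ∷ as} (triangular (above-a ∷ above) (nonzero ∷ diagonal)) c c′ c≡c′ = λ where
        zero    → head≡
        (suc i) → lincomb-injective (triangular above diagonal) (c ∘ suc) (c′ ∘ suc) tail≡ i
      where
      rest : (Fin (length (a ∷ as)) → Fin p) → Fin ℓ → ℕ
      rest d = lincomb w as (toℕ ∘ d ∘ suc)
      -- pairing both combinations with u a leaves c₀ (u a · w a) plus multiples of p
      head≡ : c zero ≡ c′ zero
      head≡ = ≡mod-*-cancelʳ p-prime nonzero (c zero) (c′ zero)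
        (≡mod-+-cancel-multiples (∣·lincomb (u a) as above-a _) (∣·lincomb (u a) as above-a _)
          (subst₂ _≡[ p ]_ (·-linearʳ (u a) (toℕ (c zero)) (w a) (rest c))
                           (·-linearʳ (u a) (toℕ (c′ zero)) (w a) (rest c′))
            (≡mod-·ʳ (u a) c≡c′)))
      tail≡ : ∀ k → rest c k ≡[ p ] rest c′ k
      tail≡ k = ≡mod-+-cancelˡ (toℕ (c zero) * w a k)
        (subst (λ z → toℕ (c zero) * w a k + rest c k ≡[ p ] toℕ z * w a k + rest c′ k)
          (sym head≡) (c≡c′ k))

    triangular-length≤ : ∀ {as} → Triangular u w p as → length as ≤ ℓ
    triangular-length≤ {as} tri =
      functionSpace-injective⇒≤ (nonTrivial⇒n>1 p {{prime⇒nonTrivial p-prime}}) reduce reduce-injective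
      where
      instance
        p≢0 : NonZero p
        p≢0 = prime⇒nonZero p-prime
      reduce : (Fin (length as) → Fin p) → Fin ℓ → Fin p
      reduce c k = lincomb w as (toℕ ∘ c) k mod p
      reduce-injective : ∀ c c′ → reduce c ≗ reduce c′ → c ≗ c′
      reduce-injective c c′ eq = lincomb-injective tri c c′ (mod≡mod⇒≡mod ∘ eq)

  triangular-length≤-squarefree : ∀ {ps as} → All Prime ps → Unique ps →
    Triangular u w (product ps) as → length as ≤ length ps * ℓ
  triangular-length≤-squarefree {[]} {[]}    _ _ _                        = z≤n
  triangular-length≤-squarefree {[]} {_ ∷ _} _ _ (triangular _ (1∤ ∷ _)) = contradiction (1∣ _) 1∤
  triangular-length≤-squarefree {p ∷ ps} {as} (p-prime ∷ ps-prime) (p∉ps ∷ ps-distinct)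
                                (triangular above diagonal) =
    ≤-trans (≤-reflexive (trans (length-filter+filter-∁ p∣diagonal? as) (+-comm (length divisibleAs) _)))
      (+-mono-≤ (triangular-length≤ p-prime nondivisible)
                (triangular-length≤-squarefree ps-prime ps-distinct divisible))
    where
    p∣diagonal? : Decidable (λ a → p ∣ u a · w a)
    p∣diagonal? a = p ∣? u a · w a
    divisibleAs : List A
    divisibleAs = filter p∣diagonal? as
    p∤ps : p ∤ product ps
    p∤ps = prime∤product p-prime ps-prime p∉ps
    divisible : Triangular u w (product ps) divisibleAs
    divisible = triangular
      (AllPairs.filter⁺ p∣diagonal? (AllPairs.map (∣-trans (n∣m*n p)) above))
      (All.zipWith (λ (p∣d , p*ps∤d) ps∣d → p*ps∤d (p∣n∧m∣n⇒p*m∣n p-prime p∤ps p∣d ps∣d))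
        (All.all-filter p∣diagonal? as , All.filter⁺ p∣diagonal? diagonal))
    nondivisible : Triangular u w p (filter (∁? p∣diagonal?) as)
    nondivisible = triangular
      (AllPairs.filter⁺ (∁? p∣diagonal?) (AllPairs.map (∣-trans (m∣m*n (product ps))) above))
      (All.all-filter (∁? p∣diagonal?) as)

∣q∣<∣p∣⇒p⊈q : ∀ {n} {S T : Subset n} → ∣ T ∣ < ∣ S ∣ → S ⊈ T
∣q∣<∣p∣⇒p⊈q ∣T∣<∣S∣ S⊆T = <⇒≱ ∣T∣<∣S∣ (p⊆q⇒∣p∣≤∣q∣ S⊆T)

subsetsOfSize : (n k : ℕ) → List (Subset n)
subsetsOfSize zero    zero    = [] ∷ []
subsetsOfSize zero    (suc k) = []
subsetsOfSize (suc n) zero    = map (outside ∷_) (subsetsOfSize n zero)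
subsetsOfSize (suc n) (suc k) = map (outside ∷_) (subsetsOfSize n (suc k)) ++ map (inside ∷_) (subsetsOfSize n k)

length-subsetsOfSize : ∀ n k → length (subsetsOfSize n k) ≡ n C k
length-subsetsOfSize zero    zero    = refl
length-subsetsOfSize zero    (suc k) = refl
length-subsetsOfSize (suc n) zero    = trans (length-map _ (subsetsOfSize n zero)) (length-subsetsOfSize n zero)
length-subsetsOfSize (suc n) (suc k) = begin
  length (map (outside ∷_) (subsetsOfSize n (suc k)) ++ map (inside ∷_) (subsetsOfSize n k))
    ≡⟨ length-++ (map (outside ∷_) (subsetsOfSize n (suc k))) ⟩
  length (map (outside ∷_) (subsetsOfSize n (suc k))) + length (map (inside ∷_) (subsetsOfSize n k))
    ≡⟨ cong₂ _+_ (trans (length-map _ (subsetsOfSize n (suc k))) (length-subsetsOfSize n (suc k)))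
                 (trans (length-map _ (subsetsOfSize n k)) (length-subsetsOfSize n k)) ⟩
  n C suc k + n C k
    ≡⟨ +-comm (n C suc k) (n C k) ⟩
  n C k + n C suc k
    ≡⟨ nCk+nC[k+1]≡[n+1]C[k+1] n k ⟩
  suc n C suc k ∎

subsetsOfSize-∣∣ : ∀ n k → All (λ S → ∣ S ∣ ≡ k) (subsetsOfSize n k)
subsetsOfSize-∣∣ zero    zero    = refl ∷ []
subsetsOfSize-∣∣ zero    (suc k) = []
subsetsOfSize-∣∣ (suc n) zero    = All.map⁺ (subsetsOfSize-∣∣ n zero)
subsetsOfSize-∣∣ (suc n) (suc k) =
  All.++⁺ (All.map⁺ (subsetsOfSize-∣∣ n (suc k))) (All.map⁺ (All.map (cong suc) (subsetsOfSize-∣∣ n k)))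

subsetsOfSize-⊈ : ∀ n k → AllPairs (λ S T → T ⊈ S) (subsetsOfSize n k)
subsetsOfSize-⊈ zero    zero    = [] ∷ []
subsetsOfSize-⊈ zero    (suc k) = []
subsetsOfSize-⊈ (suc n) zero    = AllPairs.map⁺ (AllPairs.map (_∘ drop-∷-⊆) (subsetsOfSize-⊈ n zero))
subsetsOfSize-⊈ (suc n) (suc k) = AllPairs.++⁺
  (AllPairs.map⁺ (AllPairs.map (_∘ drop-∷-⊆) (subsetsOfSize-⊈ n (suc k))))
  (AllPairs.map⁺ (AllPairs.map (_∘ drop-∷-⊆) (subsetsOfSize-⊈ n k)))
  (All.map⁺ (All.universal (λ _ → All.map⁺ (All.universal (λ _ T⊆S → contradiction (T⊆S Vec.here) λ ()) _)) _))

subsetsOfSize< : (n m : ℕ) → List (Subset n)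
subsetsOfSize< n zero    = []
subsetsOfSize< n (suc m) = subsetsOfSize< n m ++ subsetsOfSize n m

length-subsetsOfSize< : ∀ n m → length (subsetsOfSize< n m) ≡ sum (map (n C_) (upTo m))
length-subsetsOfSize< n zero    = refl
length-subsetsOfSize< n (suc m) = begin
  length (subsetsOfSize< n m ++ subsetsOfSize n m)
    ≡⟨ length-++ (subsetsOfSize< n m) ⟩
  length (subsetsOfSize< n m) + length (subsetsOfSize n m)
    ≡⟨ cong₂ _+_ (length-subsetsOfSize< n m) (length-subsetsOfSize n m) ⟩
  sum (map (n C_) (upTo m)) + n C m
    ≡⟨ cong (sum (map (n C_) (upTo m)) +_) (+-identityʳ (n C m)) ⟨
  sum (map (n C_) (upTo m)) + sum (map (n C_) (m ∷ []))
    ≡⟨ sum-++ (map (n C_) (upTo m)) _ ⟨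
  sum (map (n C_) (upTo m) ++ map (n C_) (m ∷ []))
    ≡⟨ cong sum (map-++ (n C_) (upTo m) _) ⟨
  sum (map (n C_) (upTo m ++ m ∷ []))
    ≡⟨ cong (sum ∘ map (n C_)) (upTo-∷ʳ m) ⟩
  sum (map (n C_) (upTo (suc m))) ∎

subsetsOfSize<-∣∣ : ∀ n m → All (λ S → ∣ S ∣ < m) (subsetsOfSize< n m)
subsetsOfSize<-∣∣ n zero    = []
subsetsOfSize<-∣∣ n (suc m) = All.++⁺
  (All.map m≤n⇒m≤1+n (subsetsOfSize<-∣∣ n m))
  (All.map (λ ∣S∣≡m → s≤s (≤-reflexive ∣S∣≡m)) (subsetsOfSize-∣∣ n m))

subsetsOfSize<-⊈ : ∀ n m → AllPairs (λ S T → T ⊈ S) (subsetsOfSize< n m)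
subsetsOfSize<-⊈ n zero    = []
subsetsOfSize<-⊈ n (suc m) = AllPairs.++⁺ (subsetsOfSize<-⊈ n m) (subsetsOfSize-⊈ n m)
  (All.map (λ ∣S∣<m → All.map (λ ∣T∣≡m → ∣q∣<∣p∣⇒p⊈q (subst (_ <_) (sym ∣T∣≡m) ∣S∣<m)) (subsetsOfSize-∣∣ n m))
    (subsetsOfSize<-∣∣ n m))

sumList-++ : ∀ xs ys → sumList (xs ++ ys) ≡ sumList xs + sumList ys
sumList-++ []       ys = refl
sumList-++ (x ∷ xs) ys = trans (cong (x +_) (sumList-++ xs ys)) (sym (+-assoc x _ _))

sumList-map-0 : ∀ {A : Set} (xs : List A) → sumList (map (λ _ → 0) xs) ≡ 0
sumList-map-0 []       = refl
sumList-map-0 (x ∷ xs) = sumList-map-0 xs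

sumList-allSubsets-suc : ∀ {n} (f : Subset (suc n) → ℕ) →
  sumList (map f (allSubsets (suc n))) ≡
  sumList (map (f ∘ (outside ∷_)) (allSubsets n)) + sumList (map (f ∘ (inside ∷_)) (allSubsets n))
sumList-allSubsets-suc {n} f = begin
  sumList (map f (map (outside ∷_) A ++ map (inside ∷_) A))
    ≡⟨ cong sumList (map-++ f (map (outside ∷_) A) _) ⟩
  sumList (map f (map (outside ∷_) A) ++ map f (map (inside ∷_) A))
    ≡⟨ sumList-++ (map f (map (outside ∷_) A)) _ ⟩
  sumList (map f (map (outside ∷_) A)) + sumList (map f (map (inside ∷_) A))
    ≡⟨ cong₂ _+_ (cong sumList (map-∘ A)) (cong sumList (map-∘ A)) ⟨
  sumList (map (f ∘ (outside ∷_)) A) + sumList (map (f ∘ (inside ∷_)) A) ∎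
  where
  A : List (Subset n)
  A = allSubsets n

_≟ˢ_ : ∀ {n} → (S T : Subset n) → Dec (S ≡ T)
_≟ˢ_ = ≡-dec Bool._≟_

-- Working modulo q = 2 + r makes 0 and 1 distinct elements of Fin q.
module _ {r : ℕ} where

  bit : Bool → Fin (2 + r)
  bit outside = zero
  bit inside  = suc zero

  indicator : ∀ {n} → Subset n → Vec (Fin (2 + r)) n
  indicator = Vec.map bit

  monomial-indicator-⊈ : ∀ {n} (S T : Subset n) → S ⊈ T → monomial S (indicator T) ≡ 0
  monomial-indicator-⊈ []            []            S⊈T = ⊥-elim (S⊈T ⊆-refl)
  monomial-indicator-⊈ (outside ∷ S) (_ ∷ T)       S⊈T = monomial-indicator-⊈ S T (S⊈T ∘ out⊆)
  monomial-indicator-⊈ (inside ∷ S)  (outside ∷ T) S⊈T = refl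
  monomial-indicator-⊈ (inside ∷ S)  (inside ∷ T)  S⊈T = cong (_+ 0) (monomial-indicator-⊈ S T (S⊈T ∘ s⊆s))

  monomial-indicator-self : ∀ {n} (S : Subset n) → monomial S (indicator S) ≡ 1
  monomial-indicator-self []            = refl
  monomial-indicator-self (outside ∷ S) = monomial-indicator-self S
  monomial-indicator-self (inside ∷ S)  = cong (_+ 0) (monomial-indicator-self S)

  sumList-allSubsets-δ : ∀ {n} (T : Subset n) (h : Subset n → ℕ) →
    sumList (map (λ S → toℕ (bit (does (S ≟ˢ T))) * h S) (allSubsets n)) ≡ h T
  sumList-allSubsets-δ []            h = trans (+-identityʳ _) (+-identityʳ (h []))
  sumList-allSubsets-δ {suc n} (outside ∷ T) h = begin
    _ ≡⟨ sumList-allSubsets-suc (λ S → toℕ (bit (does (S ≟ˢ (outside ∷ T)))) * h S) ⟩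
    _ ≡⟨ cong₂ _+_ (sumList-allSubsets-δ T (h ∘ (outside ∷_))) (sumList-map-0 (allSubsets n)) ⟩
    h (outside ∷ T) + 0 ≡⟨ +-identityʳ _ ⟩
    h (outside ∷ T) ∎
  sumList-allSubsets-δ {suc n} (inside ∷ T) h = begin
    _ ≡⟨ sumList-allSubsets-suc (λ S → toℕ (bit (does (S ≟ˢ (inside ∷ T)))) * h S) ⟩
    _ ≡⟨ cong₂ _+_ (sumList-map-0 (allSubsets n)) (sumList-allSubsets-δ T (h ∘ (inside ∷_))) ⟩
    h (inside ∷ T) ∎

  -- x^T, with the zero polynomial as junk value when ∣ T ∣ > d
  monomialPoly : ∀ {n} d → Subset n → MultilinPoly n d (2 + r)
  monomialPoly d T with ∣ T ∣ ≤? d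
  ... | yes ∣T∣≤d = (λ S → bit (does (S ≟ˢ T))) ,
                    λ S d<∣S∣ → cong (toℕ ∘ bit) (dec-false (S ≟ˢ T) λ { refl → <⇒≱ d<∣S∣ ∣T∣≤d })
  ... | no  _     = (λ _ → zero) , λ _ _ → refl

  eval-monomialPoly-⊈ : ∀ {n} d (S T : Subset n) → T ⊈ S → eval (monomialPoly d T) (indicator S) ≡ 0
  eval-monomialPoly-⊈ {n} d S T T⊈S with ∣ T ∣ ≤? d
  ... | yes _ = trans (sumList-allSubsets-δ T _) (monomial-indicator-⊈ T S T⊈S)
  ... | no  _ = sumList-map-0 (allSubsets n)

  eval-monomialPoly-self : ∀ {n d} (T : Subset n) → ∣ T ∣ ≤ d → eval (monomialPoly d T) (indicator T) ≡ 1
  eval-monomialPoly-self {d = d} T ∣T∣≤d with ∣ T ∣ ≤? d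
  ... | yes _      = trans (sumList-allSubsets-δ T _) (monomial-indicator-self T)
  ... | no ∣T∣≰d = contradiction ∣T∣≤d ∣T∣≰d

MPOLY-encoding⇒triangular : ∀ {n d q ℓ} → 1 < q → IPEncoding (MPOLY n d q) q ℓ →
  ∀ {Ss} → All (λ S → ∣ S ∣ ≤ d) Ss → AllPairs (λ S T → T ⊈ S) Ss →
  ∃₂ λ (u w : Subset n → Fin ℓ → ℕ) → Triangular u w q Ss
MPOLY-encoding⇒triangular {n} {d} {q@(suc (suc _))} {ℓ} (s≤s (s≤s z≤n)) (f , g , P⇔q∣ip) small ⊈s =
  u , w , triangular (AllPairs.map offDiagonal ⊈s) (All.map diagonal small)
  where
  open Equivalence
  u w : Subset n → Fin ℓ → ℕ
  u S = toℕ ∘ f (indicator S)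
  w T = toℕ ∘ g (monomialPoly d T)
  encodes : ∀ S T → (q ∣ eval (monomialPoly d T) (indicator S)) ⇔ (q ∣ u S · w T)
  encodes S T = subst (λ k → MPOLY n d q (indicator S) (monomialPoly d T) ⇔ (q ∣ k))
    (ip≡· (f (indicator S)) (g (monomialPoly d T))) (P⇔q∣ip (indicator S) (monomialPoly d T))
  offDiagonal : ∀ {S T} → T ⊈ S → q ∣ u S · w T
  offDiagonal {S} {T} T⊈S =
    to (encodes S T) (subst (q ∣_) (sym (eval-monomialPoly-⊈ d S T T⊈S)) (q ∣0))
  diagonal : ∀ {T} → ∣ T ∣ ≤ d → q ∤ u T · w T
  diagonal {T} ∣T∣≤d q∣uw
    with ∣1⇒≡1 (subst (q ∣_) (eval-monomialPoly-self T ∣T∣≤d) (from (encodes T T) q∣uw))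
  ... | ()

DI-MPOLY-squarefree : ∀ n d {ps} → All Prime ps → Unique ps → 1 ≤ length ps →
  (ℓ : ℕ) → IPEncoding (MPOLY n d (product ps)) (product ps) ℓ → n C d ≤ length ps * ℓ
DI-MPOLY-squarefree n d {ps} primes distinct nonempty ℓ enc =
  let u , w , tri = MPOLY-encoding⇒triangular (productOfPrimes>1 primes nonempty) enc
                      (All.map ≤-reflexive (subsetsOfSize-∣∣ n d)) (subsetsOfSize-⊈ n d)
  in subst (_≤ length ps * ℓ) (length-subsetsOfSize n d) (triangular-length≤-squarefree primes distinct tri)

DI-MPOLY-prime : ∀ n d {q} → Prime q → DI≥ (MPOLY n d q) q (sum (map (n C_) (upTo (suc d))))
DI-MPOLY-prime n d {q} q-prime ℓ enc =
  let u , w , tri = MPOLY-encoding⇒triangular (nonTrivial⇒n>1 q {{prime⇒nonTrivial q-prime}}) enc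
                      (All.map s≤s⁻¹ (subsetsOfSize<-∣∣ n (suc d))) (subsetsOfSize<-⊈ n (suc d))
  in subst (_≤ ℓ) (length-subsetsOfSize< n (suc d)) (triangular-length≤ q-prime tri)

mainTheorem9 : (n d q : ℕ) → 1 ≤ d → d ≤ n →
    ((ps : List ℕ) → All Prime ps → Unique ps → 1 ≤ length ps → product ps ≡ q →
      (ℓ : ℕ) → IPEncoding (MPOLY n d q) q ℓ → n C d ≤ length ps * ℓ)
    × (Prime q → DI≥ (MPOLY n d q) q (sum (map (n C_) (upTo (suc d)))))
mainTheorem9 n d q _ _ =
  (λ { ps primes distinct nonempty refl → DI-MPOLY-squarefree n d primes distinct nonempty }) ,
  DI-MPOLY-prime n d
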